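{- Let $k\ge 2$ and $n\in\mathbb{N}$, and let $A(k,n)=\{I(k,n,w): w\in S_n\}$. Then the largest element of $A(k,n)$ is smaller than the smallest element of the set $\{a\in \tfrac{1}{k}A(k,n+1): a\notin A(k,n)\}$, where $\tfrac1k A(k,n+1)=\{b/k: b\in A(k,n+1)\}$.
   Context: The infinite rooted directed $k$-ary tree has a root on layer $1$; every vertex has $k$ children, ordered left to right, on the next layer. A vertex with at least $k$ chips may fire by choosing $k$ of its labeled chips and sending the $j$th smallest to its $j$th leftmost child. Chips $0,\dots,k^n-1$ start at the root and are written in $n$-digit $k$-ary expansion. For $w\in S_n$, the strategy $F_w$ fires, for each $i\in[n]$, each vertex $v$ on layer $i$ so that all chips on $v$ whose $w_i$th most significant digit equals $j$ go to the $(j+1)$th leftmost child of $v$. $\mathcal{C}_{k,n,w}$ is the resulting stable configuration, read as the sequence of chips on layer $n+1$ from left to right, and $I(k,n,w)$ is its number of inversions. -}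

module Defs where

open import Data.Nat using (ℕ; zero; suc; _+_; _*_; _∸_; _^_; _<_; _<?_)
open import Data.Nat.DivMod using (_/_; _%_)
open import Data.Nat.Properties using (m^n≢0)
open import Data.Fin using (Fin; toℕ)
open import Data.Fin.Permutation using (Permutation′; _⟨$⟩ʳ_)
open import Data.List using (List; map; length; filter; upTo; allFin)
open import Data.Nat.ListAction using (sum)
open import Data.Product using (Σ)
open import Relation.Binary.PropositionalEquality using (_≡_)

-- The j-th most significant digit (j = 1..n) of c in its n-digit base-k
-- expansion:  ⌊ c / k^(n-j) ⌋ mod k.  (k = 0 is a dummy case; only k ≥ 2 is used.)
digit : (k n j c : ℕ) → ℕ
digit zero    n j c = 0
digit (suc k) n j c = (_/_ c (suc k ^ (n ∸ j)) {{m^n≢0 (suc k) (n ∸ j)}}) % suc k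

-- Layers 1..n are indexed by i : Fin n (layer toℕ i + 1); w ∈ S_n is a
-- permutation of Fin n, and w_i (1-based) is toℕ (w ⟨$⟩ʳ i) + 1.
-- Under F_w, at layer i the chip c is sent to the (d+1)-th leftmost child,
-- where d = digit of c in position w_i.  Hence chip c ends on layer n+1 at the
-- vertex whose left-to-right position (0-based) has base-k digits
-- (d_1, …, d_n), i.e. position  Σ_i d_i · k^(n-i).
leafPos : (k n : ℕ) → Permutation′ n → ℕ → ℕ
leafPos k n w c =
  sum (map (λ i → digit k n (suc (toℕ (w ⟨$⟩ʳ i))) c * k ^ (n ∸ suc (toℕ i)))
           (allFin n))

-- Number of inversions of the configuration C_{k,n,w} read left to right:
-- pairs of chips c < c' (both in 0..k^n-1) with c placed to the right of c'.
I : (k n : ℕ) → Permutation′ n → ℕ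
I k n w =
  sum (map (λ c' → length (filter (λ c → leafPos k n w c' <? leafPos k n w c)
                                  (upTo c')))
           (upTo (k ^ n)))

_∈A[_,_] : ℕ → ℕ → ℕ → Set
a ∈A[ k , n ] = Σ (Permutation′ n) (λ w → I k n w ≡ a)

-- The rational number b/k lies in A(k,n) (k ≥ 1) iff b = k · a for some
-- a ∈ A(k,n), i.e. iff b = k · I(k,n,v) for some v ∈ S_n.
_/_∈A[_] : ℕ → ℕ → ℕ → Set
b / k ∈A[ n ] = Σ (Permutation′ n) (λ v → k * I k n v ≡ b)

-- Write the chips in base k. The first layer of F_w reads one digit, say digit h + 1 from the top,
-- i.e. the digit of place l = n - 1 - h. Pairs of chips sent to the same child are inverted exactly
-- as in a copy of C_{k,n-1,w⁻}, where w⁻ is w without its first layer, which gives k · I(k,n-1,w⁻);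
-- pairs sent to different children are inverted iff the digits read there are, and there are
-- ((k-1)/2)² kⁿ · k^l (1 + k + ⋯ + k^(h-1)) of them. Hence I(k,n,w) = ((k-1)/2)² kⁿ Î(n,w), where
-- Î(n,w) sums k^l (1 + k + ⋯ + k^(h-1)) over the layers, and the claim becomes Î(n,w) < Î(n+1,w')
-- whenever Î(n+1,w') is not a value of Î(n,-). All values of Î(n,-) are at most
-- R(n) = ∑_{m<n} (1 + k + ⋯ + k^(m-1)). If w' reads the leading digit first, Î(n+1,w') is a value of
-- Î(n,-); otherwise Î(n+1,w') ≥ k^(n-1) > R(n) when k ≥ 3, while for k = 2 the values of Î(n,-) are
-- exactly 0, 1, …, R(n).

{-# OPTIONS --safe #-}
module Submission where

open import Defs
open import Data.Nat
  using (ℕ; zero; suc; _+_; _*_; _∸_; _^_; _≤_; _<_; _<?_; _≤?_; _≟_; z≤n; s≤s; s≤s⁻¹; NonZero; >-nonZero)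
open import Data.Nat.Properties
open import Data.Nat.DivMod
open import Data.Nat.Divisibility using (_∣_; n∣m*n; m∣m*n)
open import Data.Nat.Tactic.RingSolver using (solve-∀)
open import Data.Fin as Fin using (Fin; toℕ)
open import Data.Fin.Properties using (toℕ<n; toℕ-fromℕ<; punchOut-cong)
import Data.Fin.Permutation as Permutation
open import Data.Fin.Permutation
  using (Permutation′; _⟨$⟩ʳ_; _≈_; remove; insert; remove-insert; punchIn-permute)
open import Data.List using ([]; _∷_; _∷ʳ_; _++_; map; length; filter; upTo; tabulate)
open import Data.List.Properties using (applyUpTo-∷ʳ; map-tabulate; map-++; length-++; filter-++)
open import Data.Nat.ListAction using (sum)
open import Data.Nat.ListAction.Properties using (sum-++)
open import Algebra.Properties.CommutativeSemigroup +-commutativeSemigroup using (interchange)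
open import Data.Empty using (⊥-elim)
open import Data.Sum using (inj₁; inj₂)
open import Data.Product using (_,_; ∃; map₂)
open import Function using (_∘_)
open import Relation.Nullary using (Dec; yes; no; ¬_; contradiction)
open import Relation.Unary using (Pred; Decidable)
open import Relation.Binary.Definitions using (tri<; tri≈; tri>)
open import Relation.Binary.PropositionalEquality

∑ : ℕ → (ℕ → ℕ) → ℕ
∑ zero    f = 0
∑ (suc n) f = ∑ n f + f n

∑-cong : ∀ n {f g : ℕ → ℕ} → (∀ i → i < n → f i ≡ g i) → ∑ n f ≡ ∑ n g
∑-cong zero    f≗g = refl
∑-cong (suc n) f≗g = cong₂ _+_ (∑-cong n (λ i i<n → f≗g i (m<n⇒m<1+n i<n))) (f≗g n (n<1+n n))

∑-distrib-+ : ∀ n (f g : ℕ → ℕ) → ∑ n (λ i → f i + g i) ≡ ∑ n f + ∑ n g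
∑-distrib-+ zero    f g = refl
∑-distrib-+ (suc n) f g =
  trans (cong (_+ (f n + g n)) (∑-distrib-+ n f g)) (interchange (∑ n f) (∑ n g) (f n) (g n))

∑-*ˡ : ∀ n a (f : ℕ → ℕ) → ∑ n (λ i → a * f i) ≡ a * ∑ n f
∑-*ˡ zero    a f = sym (*-zeroʳ a)
∑-*ˡ (suc n) a f = trans (cong (_+ a * f n) (∑-*ˡ n a f)) (sym (*-distribˡ-+ a (∑ n f) (f n)))

∑-*ʳ : ∀ n a (f : ℕ → ℕ) → ∑ n (λ i → f i * a) ≡ ∑ n f * a
∑-*ʳ n a f = trans (∑-cong n (λ i _ → *-comm (f i) a)) (trans (∑-*ˡ n a f) (*-comm a (∑ n f)))

∑-const : ∀ n a → ∑ n (λ _ → a) ≡ n * a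
∑-const zero    a = refl
∑-const (suc n) a = trans (cong (_+ a) (∑-const n a)) (+-comm (n * a) a)

∑-zero : ∀ n {f : ℕ → ℕ} → (∀ i → i < n → f i ≡ 0) → ∑ n f ≡ 0
∑-zero n f≗0 = trans (∑-cong n f≗0) (trans (∑-const n 0) (*-zeroʳ n))

∑-comm : ∀ m n (f : ℕ → ℕ → ℕ) → ∑ m (λ i → ∑ n (f i)) ≡ ∑ n (λ j → ∑ m (λ i → f i j))
∑-comm zero    n f = sym (∑-zero n (λ _ _ → refl))
∑-comm (suc m) n f =
  trans (cong (_+ ∑ n (f m)) (∑-comm m n f)) (sym (∑-distrib-+ n (λ j → ∑ m (λ i → f i j)) (f m)))

∑-+ : ∀ m n (f : ℕ → ℕ) → ∑ (m + n) f ≡ ∑ m f + ∑ n (λ j → f (m + j))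
∑-+ m zero    f = trans (cong (λ k → ∑ k f) (+-identityʳ m)) (sym (+-identityʳ (∑ m f)))
∑-+ m (suc n) f = begin
  ∑ (m + suc n) f                                     ≡⟨ cong (λ k → ∑ k f) (+-suc m n) ⟩
  ∑ (m + n) f + f (m + n)                             ≡⟨ cong (_+ f (m + n)) (∑-+ m n f) ⟩
  ∑ m f + ∑ n (λ j → f (m + j)) + f (m + n)           ≡⟨ +-assoc (∑ m f) _ (f (m + n)) ⟩
  ∑ m f + (∑ n (λ j → f (m + j)) + f (m + n))         ∎
  where open ≡-Reasoning

∑-* : ∀ m n (f : ℕ → ℕ) → ∑ (m * n) f ≡ ∑ m (λ i → ∑ n (λ j → f (i * n + j)))
∑-* zero    n f = refl
∑-* (suc m) n f = begin
  ∑ (n + m * n) f                                     ≡⟨ cong (λ k → ∑ k f) (+-comm n (m * n)) ⟩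
  ∑ (m * n + n) f                                     ≡⟨ ∑-+ (m * n) n f ⟩
  ∑ (m * n) f + ∑ n (λ j → f (m * n + j))             ≡⟨ cong (_+ ∑ n (λ j → f (m * n + j))) (∑-* m n f) ⟩
  ∑ m (λ i → ∑ n (λ j → f (i * n + j))) + ∑ n (λ j → f (m * n + j)) ∎
  where open ≡-Reasoning

term≤∑ : ∀ n (f : ℕ → ℕ) {i} → i < n → f i ≤ ∑ n f
term≤∑ (suc n) f {i} i<1+n with m≤n⇒m<n∨m≡n (s≤s⁻¹ i<1+n)
... | inj₁ i<n  = ≤-trans (term≤∑ n f i<n) (m≤m+n (∑ n f) (f n))
... | inj₂ refl = m≤n+m (f n) (∑ n f)

∑-mono-≤ : ∀ {m n} (f : ℕ → ℕ) → m ≤ n → ∑ m f ≤ ∑ n f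
∑-mono-≤ {m} f m≤n with m≤n⇒∃[o]m+o≡n m≤n
... | d , refl = subst (∑ m f ≤_) (sym (∑-+ m d f)) (m≤m+n (∑ m f) _)

𝟙 : {P : Set} → Dec P → ℕ
𝟙 (yes _) = 1
𝟙 (no _)  = 0

𝟙-yes : {P : Set} (p? : Dec P) → P → 𝟙 p? ≡ 1
𝟙-yes (yes _) _ = refl
𝟙-yes (no ¬p) p = ⊥-elim (¬p p)

𝟙-no : {P : Set} (p? : Dec P) → ¬ P → 𝟙 p? ≡ 0
𝟙-no (yes p) ¬p = ⊥-elim (¬p p)
𝟙-no (no _)  _  = refl

𝟙-⇔ : {P Q : Set} (p? : Dec P) (q? : Dec Q) → (P → Q) → (Q → P) → 𝟙 p? ≡ 𝟙 q?
𝟙-⇔ (yes _) (yes _) _   _   = refl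
𝟙-⇔ (no _)  (no _)  _   _   = refl
𝟙-⇔ (yes p) (no ¬q) p⇒q _   = ⊥-elim (¬q (p⇒q p))
𝟙-⇔ (no ¬p) (yes q) _   q⇒p = ⊥-elim (¬p (q⇒p q))

𝟙-<-cong : ∀ {a b c d} → a ≡ c → b ≡ d → 𝟙 (a <? b) ≡ 𝟙 (c <? d)
𝟙-<-cong refl refl = refl

∑-δ : ∀ n (g : ℕ → ℕ) {e} → e < n → ∑ n (λ i → 𝟙 (i ≟ e) * g i) ≡ g e
∑-δ (suc n) g {e} e<1+n with n ≟ e
... | yes refl = trans (cong (_+ (g n + 0)) (∑-zero n off-diagonal)) (+-identityʳ (g n))
  where
  off-diagonal : ∀ i → i < n → 𝟙 (i ≟ n) * g i ≡ 0
  off-diagonal i i<n = cong (_* g i) (𝟙-no (i ≟ n) (<⇒≢ i<n))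
... | no n≢e = trans (+-identityʳ _) (∑-δ n g (≤∧≢⇒< (s≤s⁻¹ e<1+n) (n≢e ∘ sym)))

∑-below : ∀ {m} n (f : ℕ → ℕ) → m ≤ n → ∑ n (λ i → 𝟙 (i <? m) * f i) ≡ ∑ m f
∑-below {m} n f m≤n with m≤n⇒∃[o]m+o≡n m≤n
... | d , refl = begin
  ∑ (m + d) (λ i → 𝟙 (i <? m) * f i)                                      ≡⟨ ∑-+ m d _ ⟩
  ∑ m (λ i → 𝟙 (i <? m) * f i) + ∑ d (λ j → 𝟙 (m + j <? m) * f (m + j))   ≡⟨ cong₂ _+_ inside outside ⟩
  ∑ m f + 0                                                               ≡⟨ +-identityʳ (∑ m f) ⟩
  ∑ m f                                                                   ∎
  where
  open ≡-Reasoning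
  inside : ∑ m (λ i → 𝟙 (i <? m) * f i) ≡ ∑ m f
  inside = ∑-cong m (λ i i<m → trans (cong (_* f i) (𝟙-yes (i <? m) i<m)) (*-identityˡ (f i)))
  outside : ∑ d (λ j → 𝟙 (m + j <? m) * f (m + j)) ≡ 0
  outside = ∑-zero d (λ j _ → cong (_* f (m + j)) (𝟙-no (m + j <? m) (≤⇒≯ (m≤m+n m j))))

∑² : ℕ → ℕ → (ℕ → ℕ → ℕ) → ℕ
∑² m n f = ∑ m (λ i → ∑ n (f i))

∑²-cong : ∀ m n {f g : ℕ → ℕ → ℕ} → (∀ i j → i < m → j < n → f i j ≡ g i j) → ∑² m n f ≡ ∑² m n g
∑²-cong m n f≗g = ∑-cong m (λ i i<m → ∑-cong n (λ j j<n → f≗g i j i<m j<n))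

∑²-distrib-+ : ∀ m n (f g : ℕ → ℕ → ℕ) → ∑² m n (λ i j → f i j + g i j) ≡ ∑² m n f + ∑² m n g
∑²-distrib-+ m n f g = trans (∑-cong m (λ i _ → ∑-distrib-+ n (f i) (g i))) (∑-distrib-+ m _ _)

∑⁴ : ℕ → ℕ → (ℕ → ℕ → ℕ → ℕ → ℕ) → ℕ
∑⁴ m n F = ∑² m n (λ i j → ∑² m n (F i j))

∑⁴-cong : ∀ m n {F G : ℕ → ℕ → ℕ → ℕ → ℕ} →
          (∀ i j i' j' → i < m → j < n → i' < m → j' < n → F i j i' j' ≡ G i j i' j') → ∑⁴ m n F ≡ ∑⁴ m n G
∑⁴-cong m n F≗G = ∑²-cong m n (λ i j i<m j<n → ∑²-cong m n (λ i' j' → F≗G i j i' j' i<m j<n))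

∑⁴-distrib-+ : ∀ m n (F G : ℕ → ℕ → ℕ → ℕ → ℕ) →
               ∑⁴ m n (λ i j i' j' → F i j i' j' + G i j i' j') ≡ ∑⁴ m n F + ∑⁴ m n G
∑⁴-distrib-+ m n F G = trans (∑²-cong m n (λ i j _ _ → ∑²-distrib-+ m n (F i j) (G i j))) (∑²-distrib-+ m n _ _)

∑⁴-product : ∀ m n (f g : ℕ → ℕ → ℕ) → ∑⁴ m n (λ i j i' j' → f i i' * g j j') ≡ ∑² m m f * ∑² n n g
∑⁴-product m n f g = begin
  ∑ m (λ i → ∑ n (λ j → ∑ m (λ i' → ∑ n (λ j' → f i i' * g j j'))))
    ≡⟨ ∑-cong m (λ i _ → ∑-cong n (λ j _ → ∑-cong m (λ i' _ → ∑-*ˡ n (f i i') (g j)))) ⟩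
  ∑ m (λ i → ∑ n (λ j → ∑ m (λ i' → f i i' * ∑ n (g j))))
    ≡⟨ ∑-cong m (λ i _ → ∑-cong n (λ j _ → ∑-*ʳ m (∑ n (g j)) (f i))) ⟩
  ∑ m (λ i → ∑ n (λ j → ∑ m (f i) * ∑ n (g j)))
    ≡⟨ ∑-cong m (λ i _ → ∑-*ˡ n (∑ m (f i)) (λ j → ∑ n (g j))) ⟩
  ∑ m (λ i → ∑ m (f i) * ∑² n n g)
    ≡⟨ ∑-*ʳ m (∑² n n g) (λ i → ∑ m (f i)) ⟩
  ∑² m m f * ∑² n n g
    ∎
  where open ≡-Reasoning

∑⁴-δ : ∀ m n (F : ℕ → ℕ → ℕ) → ∑⁴ m n (λ e' r' e r → 𝟙 (e ≟ e') * F r' r) ≡ m * ∑² n n F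
∑⁴-δ m n F = begin
  ∑² m n (λ e' r' → ∑ m (λ e → ∑ n (λ r → 𝟙 (e ≟ e') * F r' r)))
    ≡⟨ ∑²-cong m n (λ e' r' _ _ → ∑-cong m (λ e _ → ∑-*ˡ n (𝟙 (e ≟ e')) (F r'))) ⟩
  ∑² m n (λ e' r' → ∑ m (λ e → 𝟙 (e ≟ e') * ∑ n (F r')))
    ≡⟨ ∑²-cong m n (λ e' r' e'<m _ → ∑-δ m (λ _ → ∑ n (F r')) e'<m) ⟩
  ∑ m (λ _ → ∑² n n F)
    ≡⟨ ∑-const m (∑² n n F) ⟩
  m * ∑² n n F
    ∎
  where open ≡-Reasoning

*+-<-* : ∀ {x X y B} → x < X → y < B → x * B + y < X * B
*+-<-* {x} {X} {y} {B} x<X y<B = begin-strict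
  x * B + y    <⟨ +-monoʳ-< (x * B) y<B ⟩
  x * B + B    ≡⟨ +-comm (x * B) B ⟩
  suc x * B    ≤⟨ *-monoˡ-≤ B x<X ⟩
  X * B        ∎
  where open ≤-Reasoning

*+-mono-< : ∀ {x x' y y' B} → y < B → x < x' → x * B + y < x' * B + y'
*+-mono-< {x' = x'} {y' = y'} {B} y<B x<x' = <-≤-trans (*+-<-* x<x' y<B) (m≤m+n (x' * B) y')

𝟙-lex : ∀ x x' {y y' B} → y < B → y' < B →
        𝟙 (x * B + y <? x' * B + y') ≡ 𝟙 (x <? x') + 𝟙 (x ≟ x') * 𝟙 (y <? y')
𝟙-lex x x' {y} {y'} {B} y<B y'<B with <-cmp x x'
... | tri< x<x' x≢x' _ = begin
  𝟙 (x * B + y <? x' * B + y')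
    ≡⟨ 𝟙-yes _ (*+-mono-< y<B x<x') ⟩
  1
    ≡⟨ cong₂ (λ a b → a + b * 𝟙 (y <? y')) (𝟙-yes (x <? x') x<x') (𝟙-no (x ≟ x') x≢x') ⟨
  𝟙 (x <? x') + 𝟙 (x ≟ x') * 𝟙 (y <? y')
    ∎
  where open ≡-Reasoning
... | tri> x≮x' x≢x' x'<x = begin
  𝟙 (x * B + y <? x' * B + y')
    ≡⟨ 𝟙-no _ (<-asym (*+-mono-< y'<B x'<x)) ⟩
  0
    ≡⟨ cong₂ (λ a b → a + b * 𝟙 (y <? y')) (𝟙-no (x <? x') x≮x') (𝟙-no (x ≟ x') x≢x') ⟨
  𝟙 (x <? x') + 𝟙 (x ≟ x') * 𝟙 (y <? y')
    ∎
  where open ≡-Reasoning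
... | tri≈ x≮x refl _ = begin
  𝟙 (x * B + y <? x * B + y')
    ≡⟨ 𝟙-⇔ _ (y <? y') (+-cancelˡ-< (x * B) y y') (+-monoʳ-< (x * B)) ⟩
  𝟙 (y <? y')
    ≡⟨ +-identityʳ (𝟙 (y <? y')) ⟨
  1 * 𝟙 (y <? y')
    ≡⟨ cong₂ (λ a b → a + b * 𝟙 (y <? y')) (𝟙-no (x <? x) x≮x) (𝟙-yes (x ≟ x) refl) ⟨
  𝟙 (x <? x) + 𝟙 (x ≟ x) * 𝟙 (y <? y')
    ∎
  where open ≡-Reasoning

sum-map-upTo : ∀ n (f : ℕ → ℕ) → sum (map f (upTo n)) ≡ ∑ n f
sum-map-upTo zero    f = refl
sum-map-upTo (suc n) f = begin
  sum (map f (upTo (suc n)))           ≡⟨ cong (sum ∘ map f) (applyUpTo-∷ʳ (λ i → i) n) ⟨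
  sum (map f (upTo n ∷ʳ n))            ≡⟨ cong sum (map-++ f (upTo n) (n ∷ [])) ⟩
  sum (map f (upTo n) ++ f n ∷ [])     ≡⟨ sum-++ (map f (upTo n)) (f n ∷ []) ⟩
  sum (map f (upTo n)) + (f n + 0)     ≡⟨ cong₂ _+_ (sum-map-upTo n f) (+-identityʳ (f n)) ⟩
  ∑ n f + f n                          ∎
  where open ≡-Reasoning

length-filter-upTo : ∀ {P : Pred ℕ _} (P? : Decidable P) n →
                     length (filter P? (upTo n)) ≡ ∑ n (λ i → 𝟙 (P? i))
length-filter-upTo P? zero    = refl
length-filter-upTo P? (suc n) = begin
  length (filter P? (upTo (suc n)))
    ≡⟨ cong (length ∘ filter P?) (applyUpTo-∷ʳ (λ i → i) n) ⟨
  length (filter P? (upTo n ++ n ∷ []))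
    ≡⟨ cong length (filter-++ P? (upTo n) (n ∷ [])) ⟩
  length (filter P? (upTo n) ++ filter P? (n ∷ []))
    ≡⟨ length-++ (filter P? (upTo n)) ⟩
  length (filter P? (upTo n)) + length (filter P? (n ∷ []))
    ≡⟨ cong₂ _+_ (length-filter-upTo P? n) (singleton n) ⟩
  ∑ n (λ i → 𝟙 (P? i)) + 𝟙 (P? n)
    ∎
  where
  open ≡-Reasoning
  singleton : ∀ x → length (filter P? (x ∷ [])) ≡ 𝟙 (P? x)
  singleton x with P? x
  ... | yes _ = refl
  ... | no _  = refl

inv : ℕ → (ℕ → ℕ) → ℕ
inv N p = ∑² N N (λ x' x → 𝟙 (x <? x') * 𝟙 (p x' <? p x))

inv-cong : ∀ N {p q : ℕ → ℕ} → (∀ x → p x ≡ q x) → inv N p ≡ inv N q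
inv-cong N p≗q = ∑²-cong N N (λ x' x _ _ → cong (𝟙 (x <? x') *_) (𝟙-<-cong (p≗q x') (p≗q x)))

inversions-list≡inv : ∀ N (p : ℕ → ℕ) →
  sum (map (λ x' → length (filter (λ x → p x' <? p x) (upTo x'))) (upTo N)) ≡ inv N p
inversions-list≡inv N p = begin
  sum (map (λ x' → length (filter (λ x → p x' <? p x) (upTo x'))) (upTo N))
    ≡⟨ sum-map-upTo N _ ⟩
  ∑ N (λ x' → length (filter (λ x → p x' <? p x) (upTo x')))
    ≡⟨ ∑-cong N (λ x' _ → length-filter-upTo (λ x → p x' <? p x) x') ⟩
  ∑ N (λ x' → ∑ x' (λ x → 𝟙 (p x' <? p x)))
    ≡⟨ ∑-cong N (λ x' x'<N → ∑-below N (λ x → 𝟙 (p x' <? p x)) (<⇒≤ x'<N)) ⟨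
  inv N p
    ∎
  where open ≡-Reasoning

[m*n+o]/n≡m : ∀ m {n o} .{{_ : NonZero n}} → o < n → (m * n + o) / n ≡ m
[m*n+o]/n≡m m {n} {o} o<n = begin
  (m * n + o) / n      ≡⟨ +-distrib-/-∣ˡ o (n∣m*n m) ⟩
  m * n / n + o / n    ≡⟨ cong₂ _+_ (m*n/n≡m m n) (m<n⇒m/n≡0 o<n) ⟩
  m + 0                ≡⟨ +-identityʳ m ⟩
  m                    ∎
  where open ≡-Reasoning

[m*n+o]%n≡o : ∀ m {n o} .{{_ : NonZero n}} → o < n → (m * n + o) % n ≡ o
[m*n+o]%n≡o m {n} {o} o<n = trans (%-remove-+ˡ o (n∣m*n m)) (m<n⇒m%n≡m o<n)

m≡m/n*n+m%n : ∀ m n .{{_ : NonZero n}} → m ≡ m / n * n + m % n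
m≡m/n*n+m%n m n = trans (m≡m%n+[m/n]*n m n) (+-comm (m % n) _)

toℕ-punchIn-< : ∀ {n} (i : Fin (suc n)) (j : Fin n) → toℕ j < toℕ i → toℕ (Fin.punchIn i j) ≡ toℕ j
toℕ-punchIn-< (Fin.suc i) Fin.zero    _         = refl
toℕ-punchIn-< (Fin.suc i) (Fin.suc j) (s≤s j<i) = cong suc (toℕ-punchIn-< i j j<i)

toℕ-punchIn-≥ : ∀ {n} (i : Fin (suc n)) (j : Fin n) → toℕ i ≤ toℕ j → toℕ (Fin.punchIn i j) ≡ suc (toℕ j)
toℕ-punchIn-≥ Fin.zero    j           _         = refl
toℕ-punchIn-≥ (Fin.suc i) (Fin.suc j) (s≤s i≤j) = cong suc (toℕ-punchIn-≥ i j i≤j)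

punchOut-cong₂ : ∀ {n} {i i' j j' : Fin (suc n)} {i≢j : i ≢ j} {i'≢j' : i' ≢ j'} →
                 i ≡ i' → j ≡ j' → Fin.punchOut i≢j ≡ Fin.punchOut i'≢j'
punchOut-cong₂ {i = i} refl refl = punchOut-cong i refl

remove-cong : ∀ {n} i {π π' : Permutation′ (suc n)} → π ≈ π' → remove i π ≈ remove i π'
remove-cong i π≈π' j = punchOut-cong₂ (π≈π' i) (π≈π' (Fin.punchIn i j))

module Radix (K1 : ℕ) where

  K : ℕ
  K = suc K1

  -- pw e = K ^ e, defined as a visible successor so that instance search finds NonZero (pw e).
  pw-1 : ℕ → ℕ
  pw : ℕ → ℕ
  pw e = suc (pw-1 e)
  pw-1 zero    = 0
  pw-1 (suc e) = pw-1 e + K1 * pw e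

  pw≡K^ : ∀ e → pw e ≡ K ^ e
  pw≡K^ zero    = refl
  pw≡K^ (suc e) = cong (K *_) (pw≡K^ e)

  pw-+ : ∀ a b → pw (a + b) ≡ pw a * pw b
  pw-+ a b = trans (pw≡K^ (a + b)) (trans (^-distribˡ-+-* K a b) (sym (cong₂ _*_ (pw≡K^ a) (pw≡K^ b))))

  -- dg a x is the digit of x at place a, i.e. of weight K^a (Defs' digit counts from the top).
  dg : ℕ → ℕ → ℕ
  dg a x = (x / pw a) % K

  digit≡dg : ∀ n j x → digit K n j x ≡ dg (n ∸ j) x
  digit≡dg n j x = cong (_% K) (/-congʳ {{m^n≢0 K (n ∸ j)}} (sym (pw≡K^ (n ∸ j))))

  dg<K : ∀ a x → dg a x < K
  dg<K a x = m%n<n (x / pw a) K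

  dg-+ : ∀ l d x → dg (l + d) x ≡ dg d (x / pw l)
  dg-+ l d x = cong (_% K) (trans (/-congʳ {m = x} (pw-+ l d)) (sym (m/n/o≡m/[n*o] x (pw l) (pw d))))

  dg-%pw : ∀ {a l} x → a < l → dg a (x % pw l) ≡ dg a x
  dg-%pw {a} {l} x a<l with m≤n⇒∃[o]m+o≡n a<l
  ... | d , refl = begin
    (x % pw (suc a + d) / pw a) % K            ≡⟨ m%[n*o]/o≡m/o%n (x % pw (suc a + d)) K (pw a) ⟨
    x % pw (suc a + d) % pw (suc a) / pw a     ≡⟨ cong (_/ pw a) (m∣n⇒o%n%m≡o%m (pw (suc a)) _ x divides) ⟩
    x % pw (suc a) / pw a                      ≡⟨ m%[n*o]/o≡m/o%n x K (pw a) ⟩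
    (x / pw a) % K                             ∎
    where
    open ≡-Reasoning
    divides : pw (suc a) ∣ pw (suc a + d)
    divides = subst (pw (suc a) ∣_) (sym (pw-+ (suc a) d)) (m∣m*n (pw d))

  -- ins l r e inserts the digit e at place l of r, shifting the higher digits of r up by one place.
  ins : ℕ → ℕ → ℕ → ℕ
  ins l r e = (r / pw l * K + e) * pw l + r % pw l

  ins/pw : ∀ l r e → ins l r e / pw l ≡ r / pw l * K + e
  ins/pw l r e = [m*n+o]/n≡m (r / pw l * K + e) (m%n<n r (pw l))

  ins%pw : ∀ l r e → ins l r e % pw l ≡ r % pw l
  ins%pw l r e = [m*n+o]%n≡o (r / pw l * K + e) (m%n<n r (pw l))

  ins/pw[1+l] : ∀ l r {e} → e < K → ins l r e / pw (suc l) ≡ r / pw l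
  ins/pw[1+l] l r {e} e<K =
    trans (cong (_/ pw (suc l)) regroup) ([m*n+o]/n≡m (r / pw l) (*+-<-* e<K (m%n<n r (pw l))))
    where
    regroup : ins l r e ≡ r / pw l * pw (suc l) + (e * pw l + r % pw l)
    regroup = ring (r / pw l) K e (pw l) (r % pw l)
      where
      ring : ∀ q k e p s → (q * k + e) * p + s ≡ q * (k * p) + (e * p + s)
      ring = solve-∀

  dg-ins-here : ∀ l r {e} → e < K → dg l (ins l r e) ≡ e
  dg-ins-here l r {e} e<K = trans (cong (_% K) (ins/pw l r e)) ([m*n+o]%n≡o (r / pw l) e<K)

  dg-ins-below : ∀ {a l} r e → a < l → dg a (ins l r e) ≡ dg a r
  dg-ins-below {a} {l} r e a<l = begin
    dg a (ins l r e)              ≡⟨ dg-%pw (ins l r e) a<l ⟨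
    dg a (ins l r e % pw l)       ≡⟨ cong (dg a) (ins%pw l r e) ⟩
    dg a (r % pw l)               ≡⟨ dg-%pw r a<l ⟩
    dg a r                        ∎
    where open ≡-Reasoning

  dg-ins-above : ∀ {a l} r {e} → e < K → l ≤ a → dg (suc a) (ins l r e) ≡ dg a r
  dg-ins-above {a} {l} r {e} e<K l≤a with m≤n⇒∃[o]m+o≡n l≤a
  ... | d , refl = begin
    dg (suc l + d) (ins l r e)             ≡⟨ dg-+ (suc l) d (ins l r e) ⟩
    dg d (ins l r e / pw (suc l))          ≡⟨ cong (dg d) (ins/pw[1+l] l r e<K) ⟩
    dg d (r / pw l)                        ≡⟨ dg-+ l d r ⟨
    dg (l + d) r                           ∎
    where open ≡-Reasoning

  ins-split : ∀ l q e {s} → s < pw l → ins l (q * pw l + s) e ≡ (q * K + e) * pw l + s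
  ins-split l q e s<pw = cong₂ (λ q' s' → (q' * K + e) * pw l + s') ([m*n+o]/n≡m q s<pw) ([m*n+o]%n≡o q s<pw)

  ∑-by-digit : ∀ h l (G : ℕ → ℕ) → ∑ (pw (suc (h + l))) G ≡ ∑ K (λ e → ∑ (pw (h + l)) (λ r → G (ins l r e)))
  ∑-by-digit h l G = begin
    ∑ (pw (suc (h + l))) G
      ≡⟨ cong (λ n → ∑ n G) (trans (pw-+ (suc h) l) (cong (_* pw l) (*-comm K (pw h)))) ⟩
    ∑ (pw h * K * pw l) G
      ≡⟨ ∑-* (pw h * K) (pw l) G ⟩
    ∑ (pw h * K) (λ x → ∑ (pw l) (λ s → G (x * pw l + s)))
      ≡⟨ ∑-* (pw h) K _ ⟩
    ∑ (pw h) (λ q → ∑ K (λ e → ∑ (pw l) (λ s → G ((q * K + e) * pw l + s))))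
      ≡⟨ ∑-comm (pw h) K _ ⟩
    ∑ K (λ e → ∑ (pw h) (λ q → ∑ (pw l) (λ s → G ((q * K + e) * pw l + s))))
      ≡⟨ ∑-cong K (λ e _ → ∑-cong (pw h) (λ q _ → ∑-cong (pw l) (λ s s<pw → cong G (ins-split l q e s<pw)))) ⟨
    ∑ K (λ e → ∑ (pw h) (λ q → ∑ (pw l) (λ s → G (ins l (q * pw l + s) e))))
      ≡⟨ ∑-cong K (λ e _ → trans (cong (λ n → ∑ n (λ r → G (ins l r e))) (pw-+ h l)) (∑-* (pw h) (pw l) _)) ⟨
    ∑ K (λ e → ∑ (pw (h + l)) (λ r → G (ins l r e)))
      ∎
    where open ≡-Reasoning

  𝟙-ins-< : ∀ l r r' {e} → 𝟙 (ins l r e <? ins l r' e) ≡ 𝟙 (r <? r')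
  𝟙-ins-< l r r' {e} = begin
    𝟙 (ins l r e <? ins l r' e)
      ≡⟨ 𝟙-lex (q * K + e) (q' * K + e) (m%n<n r (pw l)) (m%n<n r' (pw l)) ⟩
    𝟙 (q * K + e <? q' * K + e) + 𝟙 (q * K + e ≟ q' * K + e) * 𝟙 (s <? s')
      ≡⟨ cong₂ (λ a b → a + b * 𝟙 (s <? s'))
               (𝟙-⇔ (q * K + e <? q' * K + e) (q <? q') cancel-< mono-<)
               (𝟙-⇔ (q * K + e ≟ q' * K + e) (q ≟ q') cancel-≡ (cong (λ x → x * K + e))) ⟩
    𝟙 (q <? q') + 𝟙 (q ≟ q') * 𝟙 (s <? s')
      ≡⟨ 𝟙-lex q q' (m%n<n r (pw l)) (m%n<n r' (pw l)) ⟨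
    𝟙 (q * pw l + s <? q' * pw l + s')
      ≡⟨ 𝟙-<-cong (m≡m/n*n+m%n r (pw l)) (m≡m/n*n+m%n r' (pw l)) ⟨
    𝟙 (r <? r')
      ∎
    where
    open ≡-Reasoning
    q = r / pw l
    q' = r' / pw l
    s = r % pw l
    s' = r' % pw l
    cancel-< : q * K + e < q' * K + e → q < q'
    cancel-< lt = *-cancelʳ-< K q q' (+-cancelʳ-< e (q * K) (q' * K) lt)
    mono-< : q < q' → q * K + e < q' * K + e
    mono-< lt = +-monoˡ-< e (*-monoˡ-< K lt)
    cancel-≡ : q * K + e ≡ q' * K + e → q ≡ q'
    cancel-≡ eq = *-cancelʳ-≡ q q' K (+-cancelʳ-≡ e (q * K) (q' * K) eq)

  val : (m : ℕ) → (Fin m → ℕ) → ℕ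
  val zero    f = 0
  val (suc m) f = f Fin.zero * pw m + val m (f ∘ Fin.suc)

  val-cong : ∀ m {f g : Fin m → ℕ} → (∀ i → f i ≡ g i) → val m f ≡ val m g
  val-cong zero    f≗g = refl
  val-cong (suc m) f≗g = cong₂ _+_ (cong (_* pw m) (f≗g Fin.zero)) (val-cong m (f≗g ∘ Fin.suc))

  val<pw : ∀ m (f : Fin m → ℕ) → (∀ i → f i < K) → val m f < pw m
  val<pw zero    f f<K = s≤s z≤n
  val<pw (suc m) f f<K = *+-<-* (f<K Fin.zero) (val<pw m (f ∘ Fin.suc) (f<K ∘ Fin.suc))

  sum-tabulate≡val : ∀ m (f : Fin m → ℕ) → sum (tabulate (λ i → f i * K ^ (m ∸ suc (toℕ i)))) ≡ val m f
  sum-tabulate≡val zero    f = refl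
  sum-tabulate≡val (suc m) f =
    cong₂ _+_ (cong (f Fin.zero *_) (sym (pw≡K^ m))) (sum-tabulate≡val m (f ∘ Fin.suc))

  pos : (n : ℕ) → Permutation′ n → ℕ → ℕ
  pos n w x = val n (λ i → dg (n ∸ suc (toℕ (w ⟨$⟩ʳ i))) x)

  leafPos≡pos : ∀ n w x → leafPos K n w x ≡ pos n w x
  leafPos≡pos n w x = begin
    leafPos K n w x                  ≡⟨ cong sum (map-tabulate (λ i → i) term) ⟩
    sum (tabulate term)              ≡⟨ sum-tabulate≡val n digitᵢ ⟩
    val n digitᵢ                     ≡⟨ val-cong n (λ i → digit≡dg n (suc (toℕ (w ⟨$⟩ʳ i))) x) ⟩
    pos n w x                        ∎
    where
    open ≡-Reasoning
    digitᵢ : Fin n → ℕ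
    digitᵢ i = digit K n (suc (toℕ (w ⟨$⟩ʳ i))) x
    term : Fin n → ℕ
    term i = digitᵢ i * K ^ (n ∸ suc (toℕ i))

  pos<pw : ∀ n w x → pos n w x < pw n
  pos<pw n w x = val<pw n _ (λ i → dg<K (n ∸ suc (toℕ (w ⟨$⟩ʳ i))) x)

  -- Layer 1 reads digit h + 1 from the top, i.e. place l, which is where ins l puts e.
  pos-ins : ∀ h l (w : Permutation′ (suc (h + l))) → toℕ (w ⟨$⟩ʳ Fin.zero) ≡ h → ∀ r {e} → e < K →
            pos (suc (h + l)) w (ins l r e) ≡ e * pw (h + l) + pos (h + l) (remove Fin.zero w) r
  pos-ins h l w w₀≡h r {e} e<K = cong₂ _+_ (cong (_* pw (h + l)) first) (val-cong (h + l) rest)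
    where
    m = h + l
    ρ = remove Fin.zero w
    first : dg (m ∸ toℕ (w ⟨$⟩ʳ Fin.zero)) (ins l r e) ≡ e
    first rewrite w₀≡h | m+n∸m≡n h l = dg-ins-here l r e<K
    shifted : ∀ x y → x < m → (x < h → y ≡ x) → (h ≤ x → y ≡ suc x) → dg (m ∸ y) (ins l r e) ≡ dg (m ∸ suc x) r
    shifted x y x<m y≡x y≡1+x with x <? h
    ... | yes x<h rewrite y≡x x<h | +-∸-assoc 1 x<m =
          dg-ins-above r e<K (subst (_≤ m ∸ suc x) (m+n∸m≡n h l) (∸-monoʳ-≤ m x<h))
    ... | no x≮h rewrite y≡1+x (≮⇒≥ x≮h) =
          dg-ins-below r e (subst (m ∸ suc x <_) (m+n∸m≡n h l) (∸-monoʳ-< (s≤s (≮⇒≥ x≮h)) x<m))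
    rest : ∀ j → dg (m ∸ toℕ (w ⟨$⟩ʳ Fin.suc j)) (ins l r e) ≡ dg (m ∸ suc (toℕ (ρ ⟨$⟩ʳ j))) r
    rest j = trans (cong (λ t → dg (m ∸ toℕ t) (ins l r e)) (punchIn-permute w Fin.zero j)) (
      shifted (toℕ (ρ ⟨$⟩ʳ j)) _ (toℕ<n (ρ ⟨$⟩ʳ j))
        (λ x<h → toℕ-punchIn-< (w ⟨$⟩ʳ Fin.zero) (ρ ⟨$⟩ʳ j) (subst (toℕ (ρ ⟨$⟩ʳ j) <_) (sym w₀≡h) x<h))
        (λ h≤x → toℕ-punchIn-≥ (w ⟨$⟩ʳ Fin.zero) (ρ ⟨$⟩ʳ j) (subst (_≤ toℕ (ρ ⟨$⟩ʳ j)) (sym w₀≡h) h≤x)))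

  I≡inv : ∀ n w → I K n w ≡ inv (pw n) (pos n w)
  I≡inv n w = begin
    I K n w                          ≡⟨ inversions-list≡inv (K ^ n) (leafPos K n w) ⟩
    inv (K ^ n) (leafPos K n w)      ≡⟨ cong (λ N → inv N (leafPos K n w)) (pw≡K^ n) ⟨
    inv (pw n) (leafPos K n w)       ≡⟨ inv-cong (pw n) (leafPos≡pos n w) ⟩
    inv (pw n) (pos n w)             ∎
    where open ≡-Reasoning

  ∑²-by-digit : ∀ h l (F : ℕ → ℕ → ℕ) →
    ∑² (pw (suc (h + l))) (pw (suc (h + l))) F ≡ ∑⁴ K (pw (h + l)) (λ e' r' e r → F (ins l r' e') (ins l r e))
  ∑²-by-digit h l F = trans (∑-by-digit h l (λ x' → ∑ (pw (suc (h + l))) (F x')))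
                            (∑²-cong K (pw (h + l)) (λ e' r' _ _ → ∑-by-digit h l (F (ins l r' e'))))

  𝟙-ins-<-same-digit : ∀ l r r' e e' Z →
    𝟙 (ins l r e <? ins l r' e') * (𝟙 (e' ≟ e) * Z) ≡ 𝟙 (e ≟ e') * (𝟙 (r <? r') * Z)
  𝟙-ins-<-same-digit l r r' e e' Z with e ≟ e'
  ... | yes refl = begin
    𝟙 (ins l r e <? ins l r' e) * (𝟙 (e ≟ e) * Z)
      ≡⟨ cong₂ (λ a b → a * (b * Z)) (𝟙-ins-< l r r') (𝟙-yes (e ≟ e) refl) ⟩
    𝟙 (r <? r') * (1 * Z)
      ≡⟨ cong (𝟙 (r <? r') *_) (*-identityˡ Z) ⟩
    𝟙 (r <? r') * Z
      ≡⟨ *-identityˡ _ ⟨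
    1 * (𝟙 (r <? r') * Z)
      ∎
    where open ≡-Reasoning
  ... | no e≢e' = trans (cong (λ b → 𝟙 (ins l r e <? ins l r' e') * (b * Z)) (𝟙-no (e' ≟ e) (e≢e' ∘ sym)))
                        (*-zeroʳ (𝟙 (ins l r e <? ins l r' e')))

  inv-pos-step : ∀ h l (w : Permutation′ (suc (h + l))) → toℕ (w ⟨$⟩ʳ Fin.zero) ≡ h →
    inv (pw (suc (h + l))) (pos (suc (h + l)) w) ≡
    inv (pw (suc (h + l))) (dg l) + K * inv (pw (h + l)) (pos (h + l) (remove Fin.zero w))
  inv-pos-step h l w w₀≡h = begin
    inv N p⁺
      ≡⟨ ∑²-by-digit h l _ ⟩
    ∑⁴ K M (λ e' r' e r → 𝟙 (ins l r e <? ins l r' e') * 𝟙 (p⁺ (ins l r' e') <? p⁺ (ins l r e)))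
      ≡⟨ ∑⁴-cong K M (λ e' r' e r e'<K _ e<K _ → split e' r' e r e'<K e<K) ⟩
    ∑⁴ K M (λ e' r' e r → A e' r' e r + B e' r' e r)
      ≡⟨ ∑⁴-distrib-+ K M A B ⟩
    ∑⁴ K M A + ∑⁴ K M B
      ≡⟨ cong₂ _+_ (sym (∑²-by-digit h l _)) (∑⁴-δ K M (λ r' r → 𝟙 (r <? r') * 𝟙 (p r' <? p r))) ⟩
    inv N (dg l) + K * inv M p
      ∎
    where
    open ≡-Reasoning
    N = pw (suc (h + l))
    M = pw (h + l)
    ρ = remove Fin.zero w
    p⁺ = pos (suc (h + l)) w
    p = pos (h + l) ρ
    A B : ℕ → ℕ → ℕ → ℕ → ℕ
    A e' r' e r = 𝟙 (ins l r e <? ins l r' e') * 𝟙 (dg l (ins l r' e') <? dg l (ins l r e))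
    B e' r' e r = 𝟙 (e ≟ e') * (𝟙 (r <? r') * 𝟙 (p r' <? p r))
    split : ∀ e' r' e r → e' < K → e < K →
      𝟙 (ins l r e <? ins l r' e') * 𝟙 (p⁺ (ins l r' e') <? p⁺ (ins l r e)) ≡ A e' r' e r + B e' r' e r
    split e' r' e r e'<K e<K = begin
      c * 𝟙 (p⁺ (ins l r' e') <? p⁺ (ins l r e))
        ≡⟨ cong (c *_) (𝟙-<-cong (pos-ins h l w w₀≡h r' e'<K) (pos-ins h l w w₀≡h r e<K)) ⟩
      c * 𝟙 (e' * M + p r' <? e * M + p r)
        ≡⟨ cong (c *_) (𝟙-lex e' e (pos<pw (h + l) ρ r') (pos<pw (h + l) ρ r)) ⟩
      c * (𝟙 (e' <? e) + 𝟙 (e' ≟ e) * 𝟙 (p r' <? p r))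
        ≡⟨ *-distribˡ-+ c (𝟙 (e' <? e)) _ ⟩
      c * 𝟙 (e' <? e) + c * (𝟙 (e' ≟ e) * 𝟙 (p r' <? p r))
        ≡⟨ cong₂ _+_ (cong (c *_) (𝟙-<-cong (dg-ins-here l r' e'<K) (dg-ins-here l r e<K)))
                     (sym (𝟙-ins-<-same-digit l r r' e e' _)) ⟨
      A e' r' e r + B e' r' e r
        ∎
      where c = 𝟙 (ins l r e <? ins l r' e')

  P : ℕ
  P = ∑² K K (λ e e' → 𝟙 (e <? e'))

  repunit : ℕ → ℕ
  repunit zero    = 0
  repunit (suc h) = pw h + repunit h

  inv-dg-top : ∀ l → inv (pw (suc l)) (dg l) ≡ 0
  inv-dg-top l = ∑-zero N (λ x' x'<N → ∑-zero N (λ x x<N → no-inversion x' x x'<N x<N))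
    where
    N = pw (suc l)
    dg≡/ : ∀ {x} → x < N → dg l x ≡ x / pw l
    dg≡/ x<N = m<n⇒m%n≡m (m<n*o⇒m/o<n x<N)
    no-inversion : ∀ x' x → x' < N → x < N → 𝟙 (x <? x') * 𝟙 (dg l x' <? dg l x) ≡ 0
    no-inversion x' x x'<N x<N with x <? x'
    ... | no _     = refl
    ... | yes x<x' = trans (+-identityʳ _) (𝟙-no (dg l x' <? dg l x) (≤⇒≯ dg-mono))
      where
      dg-mono : dg l x ≤ dg l x'
      dg-mono = subst₂ _≤_ (sym (dg≡/ x<N)) (sym (dg≡/ x'<N)) (/-monoˡ-≤ (pw l) (<⇒≤ x<x'))

  ∑²-dg-< : ∀ h l → let N = pw (suc (h + l)) in
            ∑² N N (λ x' x → 𝟙 (dg l x' <? dg l x)) ≡ P * (pw (h + l) * pw (h + l))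
  ∑²-dg-< h l = begin
    ∑² N N (λ x' x → 𝟙 (dg l x' <? dg l x))
      ≡⟨ ∑²-by-digit h l _ ⟩
    ∑⁴ K M (λ e' r' e r → 𝟙 (dg l (ins l r' e') <? dg l (ins l r e)))
      ≡⟨ ∑⁴-cong K M (λ e' r' e r e'<K _ e<K _ → digits r' r e'<K e<K) ⟩
    ∑⁴ K M (λ e' r' e r → 𝟙 (e' <? e) * 1)
      ≡⟨ ∑⁴-product K M (λ e' e → 𝟙 (e' <? e)) (λ _ _ → 1) ⟩
    P * ∑ M (λ _ → ∑ M (λ _ → 1))
      ≡⟨ cong (P *_) (trans (∑-const M (∑ M (λ _ → 1))) (cong (M *_) (trans (∑-const M 1) (*-identityʳ M)))) ⟩
    P * (M * M)
      ∎
    where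
    open ≡-Reasoning
    N = pw (suc (h + l))
    M = pw (h + l)
    digits : ∀ {e' e} r' r → e' < K → e < K → 𝟙 (dg l (ins l r' e') <? dg l (ins l r e)) ≡ 𝟙 (e' <? e) * 1
    digits {e'} {e} r' r e'<K e<K =
      trans (𝟙-<-cong (dg-ins-here l r' e'<K) (dg-ins-here l r e<K)) (sym (*-identityʳ (𝟙 (e' <? e))))

  ∑²-by-top-digit : ∀ L (F : ℕ → ℕ → ℕ) →
    ∑² (pw (suc L)) (pw (suc L)) F ≡ ∑⁴ K (pw L) (λ e' r' e r → F (e' * pw L + r') (e * pw L + r))
  ∑²-by-top-digit L F = trans (∑-* K (pw L) _) (∑²-cong K (pw L) (λ e' r' _ _ → ∑-* K (pw L) _))

  dg-*pw+ : ∀ {a L} e {r} → a < L → r < pw L → dg a (e * pw L + r) ≡ dg a r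
  dg-*pw+ {a} {L} e {r} a<L r<pw = trans (sym (dg-%pw (e * pw L + r) a<L)) (cong (dg a) ([m*n+o]%n≡o e r<pw))

  inv-dg-suc : ∀ h l →
    inv (pw (suc (suc h + l))) (dg l) ≡ P * (P * (pw (h + l) * pw (h + l))) + K * inv (pw (suc (h + l))) (dg l)
  inv-dg-suc h l = begin
    inv (pw (suc L)) (dg l)
      ≡⟨ ∑²-by-top-digit L _ ⟩
    ∑⁴ K (pw L) (λ e' r' e r → inverted (e' * pw L + r') (e * pw L + r))
      ≡⟨ ∑⁴-cong K (pw L) (λ e' r' e r _ r'<pw _ r<pw → split e' r' e r r'<pw r<pw) ⟩
    ∑⁴ K (pw L) (λ e' r' e r → below e' e * D r' r + 𝟙 (e ≟ e') * (𝟙 (r <? r') * D r' r))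
      ≡⟨ ∑⁴-distrib-+ K (pw L) _ _ ⟩
    ∑⁴ K (pw L) (λ e' r' e r → below e' e * D r' r) +
    ∑⁴ K (pw L) (λ e' r' e r → 𝟙 (e ≟ e') * (𝟙 (r <? r') * D r' r))
      ≡⟨ cong₂ _+_ (∑⁴-product K (pw L) below D) (∑⁴-δ K (pw L) (λ r' r → 𝟙 (r <? r') * D r' r)) ⟩
    ∑² K K below * ∑² (pw L) (pw L) D + K * inv (pw L) (dg l)
      ≡⟨ cong₂ (λ a b → a * b + K * inv (pw L) (dg l)) (∑-comm K K below) (∑²-dg-< h l) ⟩
    P * (P * (pw (h + l) * pw (h + l))) + K * inv (pw L) (dg l)
      ∎
    where
    open ≡-Reasoning
    L = suc (h + l)
    inverted below D : ℕ → ℕ → ℕ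
    inverted x' x = 𝟙 (x <? x') * 𝟙 (dg l x' <? dg l x)
    below e' e = 𝟙 (e <? e')
    D r' r = 𝟙 (dg l r' <? dg l r)
    split : ∀ e' r' e r → r' < pw L → r < pw L →
      inverted (e' * pw L + r') (e * pw L + r) ≡ below e' e * D r' r + 𝟙 (e ≟ e') * (𝟙 (r <? r') * D r' r)
    split e' r' e r r'<pw r<pw = begin
      𝟙 (e * pw L + r <? e' * pw L + r') * 𝟙 (dg l (e' * pw L + r') <? dg l (e * pw L + r))
        ≡⟨ cong₂ _*_ (𝟙-lex e e' r<pw r'<pw) (𝟙-<-cong (dg-*pw+ e' l<L r'<pw) (dg-*pw+ e l<L r<pw)) ⟩
      (𝟙 (e <? e') + 𝟙 (e ≟ e') * 𝟙 (r <? r')) * D r' r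
        ≡⟨ *-distribʳ-+ (D r' r) (𝟙 (e <? e')) _ ⟩
      𝟙 (e <? e') * D r' r + 𝟙 (e ≟ e') * 𝟙 (r <? r') * D r' r
        ≡⟨ cong (𝟙 (e <? e') * D r' r +_) (*-assoc (𝟙 (e ≟ e')) _ _) ⟩
      𝟙 (e <? e') * D r' r + 𝟙 (e ≟ e') * (𝟙 (r <? r') * D r' r)
        ∎
      where l<L = s≤s (m≤n+m l h)

  inv-dg-closed : ∀ h l →
    K * K * inv (pw (suc (h + l))) (dg l) ≡ P * P * (pw (suc (h + l)) * (pw l * repunit h))
  inv-dg-closed zero    l rewrite inv-dg-top l = ring K P (pw (suc l)) (pw l)
    where
    ring : ∀ k p a b → k * k * 0 ≡ p * p * (a * (b * 0))
    ring = solve-∀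
  inv-dg-closed (suc h) l = begin
    K * K * inv (pw (suc (suc h + l))) (dg l)
      ≡⟨ cong (K * K *_) (inv-dg-suc h l) ⟩
    K * K * (P * (P * (M * M)) + K * X)
      ≡⟨ ring₁ K P M X ⟩
    K * K * (P * (P * (M * M))) + K * (K * K * X)
      ≡⟨ cong (λ t → K * K * (P * (P * (M * M))) + K * t) (inv-dg-closed h l) ⟩
    K * K * (P * (P * (M * M))) + K * (P * P * (K * M * (pw l * repunit h)))
      ≡⟨ cong (λ m → K * K * (P * (P * (m * m))) + K * (P * P * (K * m * (pw l * repunit h)))) (pw-+ h l) ⟩
    K * K * (P * (P * (pw h * pw l * (pw h * pw l)))) + K * (P * P * (K * (pw h * pw l) * (pw l * repunit h)))
      ≡⟨ ring₂ K P (pw h) (pw l) (repunit h) ⟩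
    P * P * (K * (K * (pw h * pw l)) * (pw l * (pw h + repunit h)))
      ≡⟨ cong (λ m → P * P * (K * (K * m) * (pw l * repunit (suc h)))) (pw-+ h l) ⟨
    P * P * (pw (suc (suc h + l)) * (pw l * repunit (suc h)))
      ∎
    where
    open ≡-Reasoning
    M = pw (h + l)
    X = inv (pw (suc (h + l))) (dg l)
    ring₁ : ∀ k p m x → k * k * (p * (p * (m * m)) + k * x) ≡ k * k * (p * (p * (m * m))) + k * (k * k * x)
    ring₁ = solve-∀
    ring₂ : ∀ k p a b r → k * k * (p * (p * (a * b * (a * b)))) + k * (p * p * (k * (a * b) * (b * r))) ≡
                          p * p * (k * (k * (a * b)) * (b * (a + r)))
    ring₂ = solve-∀

  lead : ℕ → ℕ → ℕ
  lead m h = pw (m ∸ h) * repunit h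

  Î : (n : ℕ) → Permutation′ n → ℕ
  Î zero    w = 0
  Î (suc m) w = lead m (toℕ (w ⟨$⟩ʳ Fin.zero)) + Î m (remove Fin.zero w)

  toℕ-w₀≤ : ∀ m (w : Permutation′ (suc m)) → toℕ (w ⟨$⟩ʳ Fin.zero) ≤ m
  toℕ-w₀≤ m w = s≤s⁻¹ (toℕ<n (w ⟨$⟩ʳ Fin.zero))

  I-step : ∀ m (w : Permutation′ (suc m)) {h l} → toℕ (w ⟨$⟩ʳ Fin.zero) ≡ h → h + l ≡ m →
    K * K * I K (suc m) w ≡ P * P * (pw (suc m) * (pw l * repunit h)) + K * (K * K * I K m (remove Fin.zero w))
  I-step .(h + l) w {h} {l} w₀≡h refl = begin
    K * K * I K (suc (h + l)) w
      ≡⟨ cong (K * K *_) (trans (I≡inv (suc (h + l)) w) (inv-pos-step h l w w₀≡h)) ⟩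
    K * K * (X + K * inv (pw (h + l)) (pos (h + l) ρ))
      ≡⟨ cong (λ t → K * K * (X + K * t)) (I≡inv (h + l) ρ) ⟨
    K * K * (X + K * I K (h + l) ρ)
      ≡⟨ ring K X (I K (h + l) ρ) ⟩
    K * K * X + K * (K * K * I K (h + l) ρ)
      ≡⟨ cong (_+ K * (K * K * I K (h + l) ρ)) (inv-dg-closed h l) ⟩
    P * P * (pw (suc (h + l)) * (pw l * repunit h)) + K * (K * K * I K (h + l) ρ)
      ∎
    where
    open ≡-Reasoning
    X = inv (pw (suc (h + l))) (dg l)
    ρ = remove Fin.zero w
    ring : ∀ k x y → k * k * (x + k * y) ≡ k * k * x + k * (k * k * y)
    ring = solve-∀

  K²I≡P²K^nÎ : ∀ n w → K * K * I K n w ≡ P * P * (pw n * Î n w)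
  K²I≡P²K^nÎ zero    w = ring K P
    where
    ring : ∀ k p → k * k * 0 ≡ p * p * (1 * 0)
    ring = solve-∀
  K²I≡P²K^nÎ (suc m) w = begin
    K * K * I K (suc m) w
      ≡⟨ I-step m w refl (m+[n∸m]≡n (toℕ-w₀≤ m w)) ⟩
    P * P * (K * pw m * (pw l * repunit h)) + K * (K * K * I K m ρ)
      ≡⟨ cong (λ t → P * P * (K * pw m * (pw l * repunit h)) + K * t) (K²I≡P²K^nÎ m ρ) ⟩
    P * P * (K * pw m * (pw l * repunit h)) + K * (P * P * (pw m * Î m ρ))
      ≡⟨ ring P K (pw m) (pw l * repunit h) (Î m ρ) ⟩
    P * P * (pw (suc m) * Î (suc m) w)
      ∎
    where
    open ≡-Reasoning
    h = toℕ (w ⟨$⟩ʳ Fin.zero)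
    l = m ∸ h
    ρ = remove Fin.zero w
    ring : ∀ p k q a b → p * p * (k * q * a) + k * (p * p * (q * b)) ≡ p * p * (k * q * (a + b))
    ring = solve-∀

  repunit-+ : ∀ h l → repunit (h + l) ≡ repunit l + pw l * repunit h
  repunit-+ zero    l = sym (trans (cong (repunit l +_) (*-zeroʳ (pw l))) (+-identityʳ (repunit l)))
  repunit-+ (suc h) l = begin
    pw (h + l) + repunit (h + l)                ≡⟨ cong₂ _+_ (pw-+ h l) (repunit-+ h l) ⟩
    pw h * pw l + (repunit l + pw l * repunit h) ≡⟨ ring (pw h) (pw l) (repunit h) (repunit l) ⟩
    repunit l + pw l * (pw h + repunit h)        ∎
    where
    open ≡-Reasoning
    ring : ∀ a b r s → a * b + (s + b * r) ≡ s + b * (a + r)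
    ring = solve-∀

  lead≤repunit : ∀ {m h} → h ≤ m → lead m h ≤ repunit m
  lead≤repunit {m} {h} h≤m = begin
    lead m h                           ≤⟨ m≤n+m (lead m h) (repunit (m ∸ h)) ⟩
    repunit (m ∸ h) + lead m h         ≡⟨ repunit-+ h (m ∸ h) ⟨
    repunit (h + (m ∸ h))              ≡⟨ cong repunit (m+[n∸m]≡n h≤m) ⟩
    repunit m                          ∎
    where open ≤-Reasoning

  Î≤∑repunit : ∀ n w → Î n w ≤ ∑ n repunit
  Î≤∑repunit zero    w = z≤n
  Î≤∑repunit (suc m) w = ≤-trans (+-mono-≤ (lead≤repunit (toℕ-w₀≤ m w)) (Î≤∑repunit m (remove Fin.zero w)))
                                 (≤-reflexive (+-comm (repunit m) (∑ m repunit)))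

  Î-cong : ∀ n {π π' : Permutation′ n} → π ≈ π' → Î n π ≡ Î n π'
  Î-cong zero    π≈π' = refl
  Î-cong (suc m) {π} {π'} π≈π' =
    cong₂ _+_ (cong (lead m ∘ toℕ) (π≈π' Fin.zero)) (Î-cong m (remove-cong Fin.zero {π} {π'} π≈π'))

  Î-insert : ∀ m (i : Fin (suc m)) ρ → Î (suc m) (insert Fin.zero i ρ) ≡ lead m (toℕ i) + Î m ρ
  Î-insert m i ρ = cong (lead m (toℕ i) +_) (Î-cong m (remove-insert Fin.zero i ρ))

  K1*repunit+1≡pw : ∀ h → K1 * repunit h + 1 ≡ pw h
  K1*repunit+1≡pw zero    = cong (_+ 1) (*-zeroʳ K1)
  K1*repunit+1≡pw (suc h) = begin
    K1 * (pw h + repunit h) + 1      ≡⟨ ring K1 (pw h) (repunit h) ⟩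
    K1 * pw h + (K1 * repunit h + 1) ≡⟨ cong (K1 * pw h +_) (K1*repunit+1≡pw h) ⟩
    K1 * pw h + pw h                 ≡⟨ +-comm (K1 * pw h) (pw h) ⟩
    pw (suc h)                       ∎
    where
    open ≡-Reasoning
    ring : ∀ k a r → k * (a + r) + 1 ≡ k * a + (k * r + 1)
    ring = solve-∀

  K1²∑repunit+1+nK1≡pw : ∀ n → K1 * K1 * ∑ n repunit + 1 + n * K1 ≡ pw n
  K1²∑repunit+1+nK1≡pw zero    = cong (λ t → t + 1 + 0) (*-zeroʳ (K1 * K1))
  K1²∑repunit+1+nK1≡pw (suc m) = begin
    K1 * K1 * (∑ m repunit + repunit m) + 1 + suc m * K1
      ≡⟨ ring K1 (∑ m repunit) (repunit m) m ⟩
    K1 * (K1 * repunit m + 1) + (K1 * K1 * ∑ m repunit + 1 + m * K1)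
      ≡⟨ cong₂ (λ a b → K1 * a + b) (K1*repunit+1≡pw m) (K1²∑repunit+1+nK1≡pw m) ⟩
    K1 * pw m + pw m
      ≡⟨ +-comm (K1 * pw m) (pw m) ⟩
    pw (suc m)
      ∎
    where
    open ≡-Reasoning
    ring : ∀ k s r m → k * k * (s + r) + 1 + suc m * k ≡ k * (k * r + 1) + (k * k * s + 1 + m * k)
    ring = solve-∀

  ∑repunit<pw : 2 ≤ K1 → ∀ n → ∑ (suc n) repunit < pw n
  ∑repunit<pw 2≤K1 n = *-cancelˡ-< (K1 * K1) (∑ (suc n) repunit) (pw n) (begin-strict
    K1 * K1 * ∑ (suc n) repunit                      <⟨ m<m+n _ (s≤s z≤n) ⟩
    K1 * K1 * ∑ (suc n) repunit + 1                  ≤⟨ m≤m+n _ (suc n * K1) ⟩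
    K1 * K1 * ∑ (suc n) repunit + 1 + suc n * K1     ≡⟨ K1²∑repunit+1+nK1≡pw (suc n) ⟩
    K * pw n                                         ≤⟨ *-monoˡ-≤ (pw n) K≤K1² ⟩
    K1 * K1 * pw n                                   ∎)
    where
    open ≤-Reasoning
    K≤K1² : K ≤ K1 * K1
    K≤K1² = begin
      suc K1       ≤⟨ +-monoˡ-≤ K1 (≤-trans (s≤s z≤n) 2≤K1) ⟩
      K1 + K1      ≡⟨ cong (K1 +_) (+-identityʳ K1) ⟨
      2 * K1       ≤⟨ *-monoˡ-≤ K1 2≤K1 ⟩
      K1 * K1      ∎

  Î-gap-k≥3 : 2 ≤ K1 → ∀ n w w' → (∀ v → Î n v ≢ Î (suc n) w') → Î n w < Î (suc n) w'
  Î-gap-k≥3 2≤K1 n w w' Î≢ = gap (toℕ (w' ⟨$⟩ʳ Fin.zero)) refl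
    where
    ρ' = remove Fin.zero w'
    gap : ∀ h → toℕ (w' ⟨$⟩ʳ Fin.zero) ≡ h → Î n w < Î (suc n) w'
    gap zero    w'₀≡0   = ⊥-elim (Î≢ ρ' (sym (begin
      Î (suc n) w'            ≡⟨ cong (λ i → lead n i + Î n ρ') w'₀≡0 ⟩
      pw n * 0 + Î n ρ'       ≡⟨ cong (_+ Î n ρ') (*-zeroʳ (pw n)) ⟩
      Î n ρ'                  ∎)))
      where open ≡-Reasoning
    gap (suc h) w'₀≡1+h = begin-strict
      Î n w                      ≤⟨ Î≤∑repunit n w ⟩
      ∑ n repunit                ≡⟨ cong (λ m → ∑ m repunit) n≡1+h+l ⟨
      ∑ (suc (h + l)) repunit    <⟨ ∑repunit<pw 2≤K1 (h + l) ⟩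
      pw (h + l)                 ≡⟨ trans (pw-+ h l) (*-comm (pw h) (pw l)) ⟩
      pw l * pw h                ≤⟨ *-monoʳ-≤ (pw l) (m≤m+n (pw h) (repunit h)) ⟩
      lead n (suc h)             ≤⟨ m≤m+n (lead n (suc h)) (Î n ρ') ⟩
      lead n (suc h) + Î n ρ'    ≡⟨ cong (λ i → lead n i + Î n ρ') w'₀≡1+h ⟨
      Î (suc n) w'               ∎
      where
      open ≤-Reasoning
      l = n ∸ suc h
      n≡1+h+l : suc (h + l) ≡ n
      n≡1+h+l = m+[n∸m]≡n (subst (_≤ n) w'₀≡1+h (toℕ-w₀≤ n w'))

  K²KI≡P²K^[1+n]Î : ∀ n w → K * K * (K * I K n w) ≡ P * P * (pw (suc n) * Î n w)
  K²KI≡P²K^[1+n]Î n w = begin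
    K * K * (K * I K n w)       ≡⟨ ring₁ K (I K n w) ⟩
    K * (K * K * I K n w)       ≡⟨ cong (K *_) (K²I≡P²K^nÎ n w) ⟩
    K * (P * P * (pw n * Î n w)) ≡⟨ ring₂ K P (pw n) (Î n w) ⟩
    P * P * (pw (suc n) * Î n w) ∎
    where
    open ≡-Reasoning
    ring₁ : ∀ k i → k * k * (k * i) ≡ k * (k * k * i)
    ring₁ = solve-∀
    ring₂ : ∀ k p q t → k * (p * p * (q * t)) ≡ p * p * (k * q * t)
    ring₂ = solve-∀

  I/K∉A⇒Î≢ : ∀ n {w'} → ¬ (I K (suc n) w' / K ∈A[ n ]) → ∀ v → Î n v ≢ Î (suc n) w'
  I/K∉A⇒Î≢ n {w'} I/K∉A v Îv≡Îw' = I/K∉A (v , *-cancelˡ-≡ (K * I K n v) (I K (suc n) w') (K * K) (begin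
    K * K * (K * I K n v)            ≡⟨ K²KI≡P²K^[1+n]Î n v ⟩
    P * P * (pw (suc n) * Î n v)     ≡⟨ cong (λ t → P * P * (pw (suc n) * t)) Îv≡Îw' ⟩
    P * P * (pw (suc n) * Î (suc n) w') ≡⟨ K²I≡P²K^nÎ (suc n) w' ⟨
    K * K * I K (suc n) w'           ∎))
    where open ≡-Reasoning

  P≥1 : 1 ≤ K1 → 1 ≤ P
  P≥1 1≤K1 = ≤-trans (term≤∑ K (λ e' → 𝟙 (0 <? e')) 1<K) (term≤∑ K (λ e → ∑ K (λ e' → 𝟙 (e <? e'))) (s≤s z≤n))
    where 1<K = s≤s 1≤K1

  Î<⇒KI<I : 1 ≤ K1 → ∀ n w w' → Î n w < Î (suc n) w' → K * I K n w < I K (suc n) w'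
  Î<⇒KI<I 1≤K1 n w w' Î<Î = *-cancelˡ-< (K * K) (K * I K n w) (I K (suc n) w') (begin-strict
    K * K * (K * I K n w)                ≡⟨ K²KI≡P²K^[1+n]Î n w ⟩
    P * P * (pw (suc n) * Î n w)         <⟨ *-monoʳ-< (P * P) {{P²≢0}} (*-monoʳ-< (pw (suc n)) Î<Î) ⟩
    P * P * (pw (suc n) * Î (suc n) w')  ≡⟨ K²I≡P²K^nÎ (suc n) w' ⟨
    K * K * I K (suc n) w'               ∎)
    where
    open ≤-Reasoning
    P²≢0 : NonZero (P * P)
    P²≢0 = >-nonZero (*-mono-≤ (P≥1 1≤K1) (P≥1 1≤K1))

module Binary where
  open Radix 1

  repunit+1≡pw : ∀ h → repunit h + 1 ≡ pw h
  repunit+1≡pw h = trans (cong (_+ 1) (sym (*-identityˡ (repunit h)))) (K1*repunit+1≡pw h)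

  ∑repunit+1+n≡pw : ∀ n → ∑ n repunit + 1 + n ≡ pw n
  ∑repunit+1+n≡pw n =
    trans (cong₂ (λ a b → a + 1 + b) (sym (*-identityˡ (∑ n repunit))) (sym (*-identityʳ n)))
          (K1²∑repunit+1+nK1≡pw n)

  pw[1+l]≡pw+pw : ∀ l → pw (suc l) ≡ pw l + pw l
  pw[1+l]≡pw+pw l = cong (pw l +_) (*-identityˡ (pw l))

  1+l≤pw : ∀ l → suc l ≤ pw l
  1+l≤pw zero    = ≤-refl
  1+l≤pw (suc l) =
    subst (suc (suc l) ≤_) (sym (pw[1+l]≡pw+pw l)) (+-mono-≤ (≤-trans (s≤s z≤n) (1+l≤pw l)) (1+l≤pw l))

  pw≤1+∑repunit : ∀ {l m} → l < m → pw l ≤ suc (∑ m repunit)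
  pw≤1+∑repunit {l} {m} l<m = ≤-trans (+-cancelʳ-≤ (suc l) (pw l) (suc (∑ (suc l) repunit)) (begin
    pw l + suc l                       ≤⟨ +-monoʳ-≤ (pw l) (1+l≤pw l) ⟩
    pw l + pw l                        ≡⟨ pw[1+l]≡pw+pw l ⟨
    pw (suc l)                         ≡⟨ ∑repunit+1+n≡pw (suc l) ⟨
    ∑ (suc l) repunit + 1 + suc l      ≡⟨ cong (_+ suc l) (+-comm (∑ (suc l) repunit) 1) ⟩
    suc (∑ (suc l) repunit) + suc l    ∎)) (s≤s (∑-mono-≤ repunit l<m))
    where open ≤-Reasoning

  lead-suc : ∀ h l → pw l * repunit (suc h) ≡ pw (suc l) * repunit h + pw l
  lead-suc h l = begin
    pw l * (pw h + repunit h)              ≡⟨ cong (λ t → pw l * (t + repunit h)) (repunit+1≡pw h) ⟨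
    pw l * (repunit h + 1 + repunit h)     ≡⟨ ring (pw l) (repunit h) ⟩
    (pw l + pw l) * repunit h + pw l       ≡⟨ cong (λ t → t * repunit h + pw l) (pw[1+l]≡pw+pw l) ⟨
    pw (suc l) * repunit h + pw l          ∎
    where
    open ≡-Reasoning
    ring : ∀ p r → p * (r + 1 + r) ≡ (p + p) * r + p
    ring = solve-∀

  lead-suc≤ : ∀ {m h} → suc h ≤ m → lead m (suc h) ≤ suc (lead m h + ∑ m repunit)
  lead-suc≤ {m} {h} 1+h≤m = begin
    pw l * repunit (suc h)                      ≡⟨ lead-suc h l ⟩
    pw (suc l) * repunit h + pw l               ≡⟨ cong (λ t → pw t * repunit h + pw l) (+-∸-assoc 1 1+h≤m) ⟨
    lead m h + pw l                             ≤⟨ +-monoʳ-≤ (lead m h) (pw≤1+∑repunit l<m) ⟩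
    lead m h + suc (∑ m repunit)                ≡⟨ +-suc (lead m h) (∑ m repunit) ⟩
    suc (lead m h + ∑ m repunit)                ∎
    where
    open ≤-Reasoning
    l = m ∸ suc h
    l<m : l < m
    l<m = subst (_≤ m) (+-∸-assoc 1 1+h≤m) (m∸n≤m m h)

  with-lead : ∀ m {h} → h ≤ m → ∀ {y} → (∃ λ ρ → Î m ρ ≡ y) → ∃ λ v → Î (suc m) v ≡ lead m h + y
  with-lead m h≤m (ρ , Îρ≡y) =
    insert Fin.zero i ρ , trans (Î-insert m i ρ) (cong₂ (λ a b → lead m a + b) (toℕ-fromℕ< (s≤s h≤m)) Îρ≡y)
    where i = Fin.fromℕ< (s≤s h≤m)

  -- The intervals [lead m h, lead m h + ∑ m repunit], h ≤ m, cover [0, ∑ (suc m) repunit]: for k = 2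
  -- consecutive left ends differ by 2^(m-1-h) ≤ 1 + ∑ m repunit.
  Î-onto : ∀ n {y} → y ≤ ∑ n repunit → ∃ λ v → Î n v ≡ y
  Î-onto-below : ∀ m h → h ≤ m → ∀ {y} → y ≤ lead m h + ∑ m repunit → ∃ λ v → Î (suc m) v ≡ y
  Î-onto-above : ∀ m h → suc h ≤ m → ∀ {y} → lead m h + ∑ m repunit < y → y ≤ lead m (suc h) + ∑ m repunit →
                 ∃ λ v → Î (suc m) v ≡ y

  Î-onto zero    y≤0 = Permutation.id , sym (n≤0⇒n≡0 y≤0)
  Î-onto (suc m) {y} y≤ = Î-onto-below m m ≤-refl (subst (y ≤_) ∑[1+m]≡ y≤)
    where
    ∑[1+m]≡ : ∑ m repunit + repunit m ≡ lead m m + ∑ m repunit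
    ∑[1+m]≡ = begin
      ∑ m repunit + repunit m          ≡⟨ +-comm (∑ m repunit) (repunit m) ⟩
      repunit m + ∑ m repunit          ≡⟨ cong (_+ ∑ m repunit) (*-identityˡ (repunit m)) ⟨
      1 * repunit m + ∑ m repunit      ≡⟨ cong (λ t → pw t * repunit m + ∑ m repunit) (n∸n≡0 m) ⟨
      lead m m + ∑ m repunit           ∎
      where open ≡-Reasoning

  Î-onto-below m zero    _ {y} y≤ =
    map₂ (λ Îv≡ → trans Îv≡ (cong (_+ y) (*-zeroʳ (pw m))))
         (with-lead m z≤n (Î-onto m (subst (y ≤_) (cong (_+ ∑ m repunit) (*-zeroʳ (pw m))) y≤)))
  Î-onto-below m (suc h) 1+h≤m {y} y≤ with y ≤? lead m h + ∑ m repunit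
  ... | yes y≤′ = Î-onto-below m h (<⇒≤ 1+h≤m) y≤′
  ... | no  y≰  = Î-onto-above m h 1+h≤m (≰⇒> y≰) y≤

  Î-onto-above m h 1+h≤m {y} lt y≤ =
    map₂ (λ Îv≡ → trans Îv≡ (m+[n∸m]≡n lead≤y)) (with-lead m 1+h≤m (Î-onto m y∸lead≤))
    where
    lead≤y : lead m (suc h) ≤ y
    lead≤y = ≤-trans (lead-suc≤ 1+h≤m) lt
    y∸lead≤ : y ∸ lead m (suc h) ≤ ∑ m repunit
    y∸lead≤ = subst (y ∸ lead m (suc h) ≤_) (m+n∸m≡n (lead m (suc h)) _) (∸-monoˡ-≤ (lead m (suc h)) y≤)

  Î-gap-k≡2 : ∀ n w w' → (∀ v → Î n v ≢ Î (suc n) w') → Î n w < Î (suc n) w'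
  Î-gap-k≡2 n w w' Î≢ with Î (suc n) w' ≤? ∑ n repunit
  ... | yes Îw'≤ = let (v , Îv≡Îw') = Î-onto n Îw'≤ in contradiction Îv≡Îw' (Î≢ v)
  ... | no  Îw'≰ = ≤-<-trans (Î≤∑repunit n w) (≰⇒> Îw'≰)

Î-gap : ∀ k n w w' → let open Radix (suc k) in (∀ v → Î n v ≢ Î (suc n) w') → Î n w < Î (suc n) w'
Î-gap zero    = Binary.Î-gap-k≡2
Î-gap (suc k) = Radix.Î-gap-k≥3 (suc (suc k)) (s≤s (s≤s z≤n))

proposition4p12 : (k n : ℕ) → 2 ≤ k →
    (w : Permutation′ n) (w' : Permutation′ (suc n)) →
    ¬ (I k (suc n) w' / k ∈A[ n ]) →
    k * I k n w < I k (suc n) w'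
proposition4p12 (suc (suc k)) n (s≤s (s≤s z≤n)) w w' I/k∉A =
  Radix.Î<⇒KI<I (suc k) (s≤s z≤n) n w w' (Î-gap k n w w' (Radix.I/K∉A⇒Î≢ (suc k) n {w'} I/k∉A))
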